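{- Let $S$ be the schedule constructed by algorithm PLTR on a feasible instance, and let $\mathrm{vol}(t)$ denote the number of jobs scheduled by $S$ at slot $t$ and $\mathrm{vol}(Q)=\sum_{t\in Q}\mathrm{vol}(t)$. For every engagement $t$ of some processor $k\in[m]$ in $S$, there exists a set $Q\subseteq T$ with $t\in Q$ such that (1) $\mathrm{fv}(Q) = \mathrm{vol}(Q)$, (2) $\mathrm{vol}(t') \ge k-1$ for all $t' \in Q$, and (3) $\mathrm{vol}(t') \ge k$ for all $t' \in Q$ with $t' \ge t$.
   Context: Problem: $m\ge1$ processors numbered $1,\dots,m$; a set $J$ of jobs, each with integer release time $r_j$, deadline $d_j$, processing volume $p_j$; time slots $T=\{0,\dots,d\}$; $E_j=\{t\in T: r_j\le t\le d_j\}$. A feasible schedule assigns to each processor and slot at most one job such that every job $j$ occupies exactly $p_j$ distinct slots of $E_j$ and is never on two processors in the same slot. A processor is busy at $t$ if a job is assigned to it at $t$. A busy interval of processor $k$ is an inclusion-maximal interval of slots in which $k$ is busy; a slot $t$ is an engagement of processor $k$ if $t=\min B$ for some busy interval $B$ of $k$. Forced volume: $\mathrm{fv}(Q)=\sum_{j\in J}\max\{0,p_j-|E_j\setminus Q|\}$. Algorithm PLTR: initialize $m_t\gets m$, $l_t\gets0$ for all $t$. For $k=m,\dots,1$: $t\gets0$; while $t\le d$: $t\gets\mathrm{KeepIdle}(k,t)$; $t\gets\mathrm{KeepBusy}(k,t)$. $\mathrm{KeepIdle}(k,t)$ finds the maximal $t'>t$ such that there is still a feasible schedule with $l_{s}\le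 \#\{\text{busy processors at } s\}\le m_{s}$ for all $s$ after setting $m_{t''}=k-1$ for all $t''\in[t,t')$, applies this update and returns $t'$; $\mathrm{KeepBusy}(k,t)$ does the same with the update $l_{t''}\gets\max\{k,l_{t''}\}$ for $t''\in[t,t')$. The output schedule is a feasible schedule respecting the final bounds, obtained from a maximum flow, with the jobs at each slot placed on the lowest-numbered processors (so processors $1,\dots,\mathrm{vol}(t)$ are busy at $t$). -}

module Defs where

open import Data.Nat using (ℕ; zero; suc; _+_; _∸_; _≤_; _<_; _⊔_; _≤?_; _<?_)
open import Data.Bool using (Bool; true; false; if_then_else_; _∧_; not)
open import Data.Fin using (Fin)
import Data.Fin as Fin
open import Data.Maybe using (Maybe; just; nothing; is-just)
open import Data.List using (List; map; upTo; allFin)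
open import Data.Nat.ListAction using (sum)
open import Data.Bool.ListAction using (any)
open import Data.Product using (Σ; ∃; _×_; _,_)
open import Relation.Nullary using (¬_)
open import Relation.Nullary.Decidable using (⌊_⌋)
open import Relation.Binary.PropositionalEquality using (_≡_)

-- A scheduling instance: m processors (numbered 1..m), n jobs (indexed by
-- Fin n), time slots T = {0,…,d}; job j has release rel j, deadline dl j,
-- processing volume p j.
record Instance : Set where
  field
    m : ℕ
    n : ℕ
    d : ℕ
    rel : Fin n → ℕ
    dl : Fin n → ℕ
    p : Fin n → ℕ

open Instance public

slots : ℕ → List ℕ
slots d = upTo (suc d)

procs : ℕ → List ℕ
procs m = map suc (upTo m)

count : List ℕ → (ℕ → Bool) → ℕ
count xs P = sum (map (λ x → if P x then 1 else 0) xs)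

-- a schedule: processor ↦ slot ↦ (possibly) job
Schedule : Instance → Set
Schedule I = ℕ → ℕ → Maybe (Fin (n I))

inE : (I : Instance) → Fin (n I) → ℕ → Bool
inE I j t = ⌊ rel I j ≤? t ⌋ ∧ (⌊ t ≤? dl I j ⌋ ∧ ⌊ t ≤? d I ⌋)

isJob : {k : ℕ} → Maybe (Fin k) → Fin k → Bool
isJob nothing j = false
isJob (just i) j = ⌊ i Fin.≟ j ⌋

runs : (I : Instance) → Schedule I → Fin (n I) → ℕ → Bool
runs I S j t = any (λ k → isJob (S k t) j) (procs (m I))

vol : (I : Instance) → Schedule I → ℕ → ℕ
vol I S t = count (procs (m I)) (λ k → is-just (S k t))

FeasibleSchedule : (I : Instance) → Schedule I → Set
FeasibleSchedule I S =
  (∀ k t j → S k t ≡ just j →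
     (1 ≤ k) × (k ≤ m I) × (t ≤ d I) × (rel I j ≤ t) × (t ≤ dl I j))
  × (∀ k k' t j → S k t ≡ just j → S k' t ≡ just j → k ≡ k')
  × (∀ j → count (slots (d I)) (runs I S j) ≡ p I j)

FeasibleInstance : Instance → Set
FeasibleInstance I = Σ (Schedule I) λ S → FeasibleSchedule I S

RespectsBounds : (I : Instance) → Schedule I → (ℕ → ℕ) → (ℕ → ℕ) → Set
RespectsBounds I S mb lb = ∀ t → t ≤ d I → (lb t ≤ vol I S t) × (vol I S t ≤ mb t)

FeasibleBounds : (I : Instance) → (ℕ → ℕ) → (ℕ → ℕ) → Set
FeasibleBounds I mb lb =
  Σ (Schedule I) λ S → FeasibleSchedule I S × RespectsBounds I S mb lb

inRange : ℕ → ℕ → ℕ → Bool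
inRange a b s = ⌊ a ≤? s ⌋ ∧ ⌊ s <? b ⌋

-- KeepIdle update: m_s ← k-1 for s ∈ [a,b)
capM : ℕ → ℕ → ℕ → (ℕ → ℕ) → (ℕ → ℕ)
capM k a b mb s = if inRange a b s then k ∸ 1 else mb s

-- KeepBusy update: l_s ← max{k, l_s} for s ∈ [a,b)
raiseL : ℕ → ℕ → ℕ → (ℕ → ℕ) → (ℕ → ℕ)
raiseL k a b lb s = if inRange a b s then k ⊔ lb s else lb s

-- KeepIdle(k,t) with current bounds (mb, lb) returns t' (maximal in [t, d+1])
KeepIdle : (I : Instance) → ℕ → ℕ → (ℕ → ℕ) → (ℕ → ℕ) → ℕ → Set
KeepIdle I k t mb lb t' =
  (t ≤ t') × (t' ≤ suc (d I)) × FeasibleBounds I (capM k t t' mb) lb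
  × (∀ u → t' < u → u ≤ suc (d I) → ¬ FeasibleBounds I (capM k t u mb) lb)

-- KeepBusy(k,t) with current bounds (mb, lb) returns t' (maximal in [t, d+1])
KeepBusy : (I : Instance) → ℕ → ℕ → (ℕ → ℕ) → (ℕ → ℕ) → ℕ → Set
KeepBusy I k t mb lb t' =
  (t ≤ t') × (t' ≤ suc (d I)) × FeasibleBounds I mb (raiseL k t t' lb)
  × (∀ u → t' < u → u ≤ suc (d I) → ¬ FeasibleBounds I mb (raiseL k t u lb))

-- Loop I k t mb lb mb' lb': the while-loop for processor k, started at slot t
-- with bounds (mb, lb), terminates with bounds (mb', lb').
data Loop (I : Instance) (k : ℕ) : ℕ → (ℕ → ℕ) → (ℕ → ℕ) → (ℕ → ℕ) → (ℕ → ℕ) → Set where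
  stop : ∀ {t mb lb} → d I < t → Loop I k t mb lb mb lb
  step : ∀ {t t₁ t₂ mb lb mb' lb'} → t ≤ d I →
         KeepIdle I k t mb lb t₁ →
         KeepBusy I k t₁ (capM k t t₁ mb) lb t₂ →
         Loop I k t₂ (capM k t t₁ mb) (raiseL k t₁ t₂ lb) mb' lb' →
         Loop I k t mb lb mb' lb'

-- Outer I k mb lb mb' lb': the for-loop over processors k, k-1, …, 1.
data Outer (I : Instance) : ℕ → (ℕ → ℕ) → (ℕ → ℕ) → (ℕ → ℕ) → (ℕ → ℕ) → Set where
  done : ∀ {mb lb} → Outer I zero mb lb mb lb
  next : ∀ {k mb lb mb₁ lb₁ mb' lb'} →
         Loop I (suc k) 0 mb lb mb₁ lb₁ →
         Outer I k mb₁ lb₁ mb' lb' →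
         Outer I (suc k) mb lb mb' lb'

PLTRBounds : (I : Instance) → (ℕ → ℕ) → (ℕ → ℕ) → Set
PLTRBounds I mb lb = Outer I (m I) (λ _ → m I) (λ _ → 0) mb lb

Busy : (I : Instance) → Schedule I → ℕ → ℕ → Set
Busy I S k t = ∃ λ j → S k t ≡ just j

LowestProcessors : (I : Instance) → Schedule I → Set
LowestProcessors I S = ∀ k t → 1 ≤ k → k ≤ m I → t ≤ d I →
  (Busy I S k t → k ≤ vol I S t) × (k ≤ vol I S t → Busy I S k t)

PLTROutput : (I : Instance) → Schedule I → Set
PLTROutput I S = Σ (ℕ → ℕ) λ mb → Σ (ℕ → ℕ) λ lb →
  PLTRBounds I mb lb × FeasibleSchedule I S × RespectsBounds I S mb lb
  × LowestProcessors I S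

BusyOn : (I : Instance) → Schedule I → ℕ → ℕ → ℕ → Set
BusyOn I S k a b = ∀ s → a ≤ s → s ≤ b → Busy I S k s

BusyInterval : (I : Instance) → Schedule I → ℕ → ℕ → ℕ → Set
BusyInterval I S k a b =
  (a ≤ b) × (b ≤ d I) × BusyOn I S k a b
  × (∀ a' b' → a' ≤ a → b ≤ b' → b' ≤ d I → BusyOn I S k a' b' → (a' ≡ a) × (b' ≡ b))

Engagement : (I : Instance) → Schedule I → ℕ → ℕ → Set
Engagement I S k t = ∃ λ b → BusyInterval I S k t b

-- forced volume fv(Q) = Σ_j max{0, p_j - |E_j \ Q|}, Q given as a Boolean predicate
fv : (I : Instance) → (ℕ → Bool) → ℕ
fv I Q = sum (map (λ j → p I j ∸ count (slots (d I)) (λ t → inE I j t ∧ not (Q t)))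
                  (allFin (n I)))

volQ : (I : Instance) → Schedule I → (ℕ → Bool) → ℕ
volQ I S Q = sum (map (λ t → if Q t then vol I S t else 0) (slots (d I)))

{-# OPTIONS --safe #-}
-- Let v = vol(t) ≥ k. Then t is also an engagement of processor v, and in the round of processor
-- v the loop of PLTR ends a KeepIdle phase exactly at t: slots of an idle phase have capacity
-- v - 1, and inside a KeepBusy phase the preceding slot already has lower bound v. By maximality
-- of KeepIdle, lowering the capacity of t to v - 1 is infeasible. Let Q be the set of slots
-- reachable from t by moving a job from a slot where it runs to a slot of its window where it
-- does not. Moving jobs along such a path shifts one unit of volume from t to its end; so every
-- slot of Q is filled to its capacity, which gives (2) and (3). No job can leave Q, so every job
-- running in Q occupies its whole window outside Q, which gives fv(Q) = vol(Q).
module Submission where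

open import Defs
open import Data.Bool using (Bool; true; false; if_then_else_; _∧_; _∨_; not)
open import Data.Bool.Properties using (∨-zeroʳ; ∨-identityʳ; ∨-assoc; ∧-zeroʳ; not-¬; ¬-not; not-injective; T-≡)
open import Data.Bool.ListAction using (any; or)
open import Data.Fin using (Fin; zero; suc)
import Data.Fin as Fin
open import Data.List using ([]; _∷_; _++_; [_]; map; upTo; allFin; tabulate)
open import Data.List.Properties using (upTo-∷ʳ; map-++; map-∘; map-cong; map-tabulate)
open import Data.List.Membership.Propositional using (lose)
open import Data.List.Membership.Propositional.Properties using (∈-allFin)
open import Data.List.Relation.Unary.Any using (satisfied)
open import Data.List.Relation.Unary.Any.Properties using (any⁺; any⁻)
open import Data.Maybe using (Maybe; just; nothing; is-just)
open import Data.Nat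
open import Data.Nat.ListAction using (sum)
open import Data.Nat.ListAction.Properties using (sum-++)
open import Data.Nat.Properties
open import Algebra.Properties.CommutativeMonoid.Sum +-0-commutativeMonoid
  using (sum-cong-≗; sum-replicate-zero; sum-syntax)
  renaming (sum to ∑)
open import Algebra.Properties.CommutativeSemigroup +-commutativeSemigroup using (interchange; xy∙z≈xz∙y)
open import Data.Product using (Σ; ∃-syntax; _×_; _,_; proj₁; proj₂)
open import Data.Sum using (_⊎_; inj₁; inj₂)
import Data.Sum
open import Data.Unit using (⊤)
open import Function using (_∘_; case_of_)
open import Function.Bundles using (Equivalence)
open import Relation.Binary using (tri<; tri≈; tri>)
open import Relation.Binary.PropositionalEquality hiding ([_])
open import Relation.Nullary using (¬_; yes; no; contradiction)
open import Relation.Nullary.Decidable using (Dec; ⌊_⌋; dec-true; dec-false; isYes≗does)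

⌊⌋-true : ∀ {A : Set} (a? : Dec A) → A → ⌊ a? ⌋ ≡ true
⌊⌋-true a? a = trans (isYes≗does a?) (dec-true a? a)

⌊⌋-false : ∀ {A : Set} (a? : Dec A) → ¬ A → ⌊ a? ⌋ ≡ false
⌊⌋-false a? ¬a = trans (isYes≗does a?) (dec-false a? ¬a)

∧-true : ∀ {a b} → a ∧ b ≡ true → a ≡ true × b ≡ true
∧-true {true} b = refl , b

∨-true : ∀ {a b} → a ∨ b ≡ true → a ≡ true ⊎ b ≡ true
∨-true {true}  _ = inj₁ refl
∨-true {false} b = inj₂ b

𝟙 : Bool → ℕ
𝟙 b = if b then 1 else 0

𝟙≤1 : ∀ b → 𝟙 b ≤ 1
𝟙≤1 true  = ≤-refl
𝟙≤1 false = z≤n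

sum< : ℕ → (ℕ → ℕ) → ℕ
sum< zero    f = 0
sum< (suc n) f = sum< n f + f n

any< : ℕ → (ℕ → Bool) → Bool
any< zero    P = false
any< (suc n) P = any< n P ∨ P n

sum<-cong : ∀ n {f g : ℕ → ℕ} → (∀ x → x < n → f x ≡ g x) → sum< n f ≡ sum< n g
sum<-cong zero    f≗g = refl
sum<-cong (suc n) f≗g = cong₂ _+_ (sum<-cong n (λ x x<n → f≗g x (m<n⇒m<1+n x<n))) (f≗g n ≤-refl)

sum<-zero : ∀ n {f : ℕ → ℕ} → (∀ x → x < n → f x ≡ 0) → sum< n f ≡ 0
sum<-zero zero    f≗0 = refl
sum<-zero (suc n) f≗0 = cong₂ _+_ (sum<-zero n (λ x x<n → f≗0 x (m<n⇒m<1+n x<n))) (f≗0 n ≤-refl)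

sum<-distrib-+ : ∀ n (f g : ℕ → ℕ) → sum< n (λ x → f x + g x) ≡ sum< n f + sum< n g
sum<-distrib-+ zero    f g = refl
sum<-distrib-+ (suc n) f g rewrite sum<-distrib-+ n f g = interchange (sum< n f) (sum< n g) (f n) (g n)

sum<-mono-≤ : ∀ n {f g : ℕ → ℕ} → (∀ x → x < n → f x ≤ g x) → sum< n f ≤ sum< n g
sum<-mono-≤ zero    f≤g = z≤n
sum<-mono-≤ (suc n) f≤g = +-mono-≤ (sum<-mono-≤ n (λ x x<n → f≤g x (m<n⇒m<1+n x<n))) (f≤g n ≤-refl)

sum<-mono-< : ∀ n {f g : ℕ → ℕ} → (∀ x → x < n → f x ≤ g x) →
              ∀ a → a < n → f a < g a → sum< n f < sum< n g
sum<-mono-< (suc n) f≤g a a<1+n fa<ga with m≤n⇒m<n∨m≡n (≤-pred a<1+n)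
... | inj₁ a<n = +-mono-<-≤ (sum<-mono-< n (λ x x<n → f≤g x (m<n⇒m<1+n x<n)) a a<n fa<ga) (f≤g n ≤-refl)
... | inj₂ refl = +-mono-≤-< (sum<-mono-≤ n (λ x x<n → f≤g x (m<n⇒m<1+n x<n))) fa<ga

sum<-𝟙≤ : ∀ n (P : ℕ → Bool) → sum< n (λ x → 𝟙 (P x)) ≤ n
sum<-𝟙≤ zero    P = z≤n
sum<-𝟙≤ (suc n) P = ≤-trans (+-mono-≤ (sum<-𝟙≤ n P) (𝟙≤1 (P n))) (≤-reflexive (+-comm n 1))

sum<-𝟙<⇒false : ∀ n (P : ℕ → Bool) → sum< n (λ x → 𝟙 (P x)) < n → ∃[ x ] x < n × P x ≡ false
sum<-𝟙<⇒false (suc n) P count<n with P n in Pn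
... | false = n , ≤-refl , Pn
... | true with sum<-𝟙<⇒false n P (≤-pred (subst (_< suc n) (+-comm _ 1) count<n))
...   | x , x<n , Px = x , m<n⇒m<1+n x<n , Px

sum<-update : ∀ n (f g : ℕ → ℕ) a → a < n → (∀ x → x < n → x ≢ a → f x ≡ g x) →
              sum< n f + g a ≡ sum< n g + f a
sum<-update (suc n) f g a a<1+n f≗g with m≤n⇒m<n∨m≡n (≤-pred a<1+n)
... | inj₂ refl = begin
    sum< n f + f n + g n ≡⟨ cong (λ s → s + f n + g n) (sum<-cong n (λ x x<n → f≗g x (m<n⇒m<1+n x<n) (<⇒≢ x<n))) ⟩
    sum< n g + f n + g n ≡⟨ xy∙z≈xz∙y (sum< n g) (f n) (g n) ⟩
    sum< n g + g n + f n ∎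
  where open ≡-Reasoning
... | inj₁ a<n = begin
    sum< n f + f n + g a ≡⟨ xy∙z≈xz∙y (sum< n f) (f n) (g a) ⟩
    sum< n f + g a + f n ≡⟨ cong₂ _+_ (sum<-update n f g a a<n (λ x x<n → f≗g x (m<n⇒m<1+n x<n))) (f≗g n ≤-refl (>⇒≢ a<n)) ⟩
    sum< n g + f a + g n ≡⟨ xy∙z≈xz∙y (sum< n g) (f a) (g n) ⟩
    sum< n g + g n + f a ∎
  where open ≡-Reasoning

sum<-𝟙-unique : ∀ n (P : ℕ → Bool) → (∀ x y → x < n → y < n → P x ≡ true → P y ≡ true → x ≡ y) →
                sum< n (λ x → 𝟙 (P x)) ≡ 𝟙 (any< n P)
sum<-𝟙-unique zero    P unique = refl
sum<-𝟙-unique (suc n) P unique with P n in Pn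
... | false rewrite ∨-identityʳ (any< n P) | +-identityʳ (sum< n (λ x → 𝟙 (P x))) =
  sum<-𝟙-unique n P (λ x y x<n y<n → unique x y (m<n⇒m<1+n x<n) (m<n⇒m<1+n y<n))
... | true rewrite ∨-zeroʳ (any< n P) = cong (_+ 1) (sum<-zero n none)
  where
  none : ∀ x → x < n → 𝟙 (P x) ≡ 0
  none x x<n with P x in Px
  ... | false = refl
  ... | true  = contradiction (unique x n (m<n⇒m<1+n x<n) ≤-refl Px Pn) (<⇒≢ x<n)

any<-intro : ∀ n (P : ℕ → Bool) x → x < n → P x ≡ true → any< n P ≡ true
any<-intro (suc n) P x x<1+n Px with m≤n⇒m<n∨m≡n (≤-pred x<1+n)
... | inj₁ x<n  rewrite any<-intro n P x x<n Px = refl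
... | inj₂ refl rewrite Px = ∨-zeroʳ (any< n P)

any<-witness : ∀ n (P : ℕ → Bool) → any< n P ≡ true → ∃[ x ] x < n × P x ≡ true
any<-witness (suc n) P found with any< n P in foundₙ
... | true  = let x , x<n , Px = any<-witness n P foundₙ in x , m<n⇒m<1+n x<n , Px
... | false = n , ≤-refl , found

search< : ∀ n (P : ℕ → Bool) → (∃[ x ] x < n × P x ≡ true) ⊎ (∀ x → x < n → P x ≡ false)
search< zero    P = inj₂ (λ x ())
search< (suc n) P with search< n P | P n in Pn
... | inj₁ (x , x<n , Px) | _     = inj₁ (x , m<n⇒m<1+n x<n , Px)
... | inj₂ _              | true  = inj₁ (n , ≤-refl , Pn)
... | inj₂ none           | false = inj₂ λ x x<1+n → case m≤n⇒m<n∨m≡n (≤-pred x<1+n) of λ where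
      (inj₁ x<n) → none x x<n
      (inj₂ refl) → Pn

sum-map-upTo : ∀ n (f : ℕ → ℕ) → sum (map f (upTo n)) ≡ sum< n f
sum-map-upTo zero    f = refl
sum-map-upTo (suc n) f = begin
  sum (map f (upTo (suc n)))       ≡⟨ cong (sum ∘ map f) (upTo-∷ʳ n) ⟨
  sum (map f (upTo n ++ [ n ]))    ≡⟨ cong sum (map-++ f (upTo n) [ n ]) ⟩
  sum (map f (upTo n) ++ [ f n ])  ≡⟨ sum-++ (map f (upTo n)) [ f n ] ⟩
  sum (map f (upTo n)) + (f n + 0) ≡⟨ cong₂ _+_ (sum-map-upTo n f) (+-identityʳ (f n)) ⟩
  sum< n f + f n                   ∎
  where open ≡-Reasoning

any-upTo : ∀ n (P : ℕ → Bool) → any P (upTo n) ≡ any< n P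
any-upTo zero    P = refl
any-upTo (suc n) P = begin
  any P (upTo (suc n))             ≡⟨ cong (any P) (upTo-∷ʳ n) ⟨
  or (map P (upTo n ++ [ n ]))     ≡⟨ cong or (map-++ P (upTo n) [ n ]) ⟩
  or (map P (upTo n) ++ [ P n ])   ≡⟨ or-++ (map P (upTo n)) [ P n ] ⟩
  any P (upTo n) ∨ (P n ∨ false)   ≡⟨ cong₂ _∨_ (any-upTo n P) (∨-identityʳ (P n)) ⟩
  any< n P ∨ P n                   ∎
  where
  open ≡-Reasoning
  or-++ : ∀ xs ys → or (xs ++ ys) ≡ or xs ∨ or ys
  or-++ []       ys = refl
  or-++ (x ∷ xs) ys rewrite or-++ xs ys = sym (∨-assoc x (or xs) (or ys))

sum-map-allFin : ∀ n (g : Fin n → ℕ) → sum (map g (allFin n)) ≡ ∑[ j < n ] g j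
sum-map-allFin n g = trans (cong sum (map-tabulate (λ j → j) g)) (sum-tabulate n g)
  where
  sum-tabulate : ∀ n (g : Fin n → ℕ) → sum (tabulate g) ≡ ∑[ j < n ] g j
  sum-tabulate zero    g = refl
  sum-tabulate (suc n) g = cong (g zero +_) (sum-tabulate n (λ j → g (suc j)))

∑-sum<-comm : ∀ n m (h : Fin n → ℕ → ℕ) → ∑[ j < n ] sum< m (h j) ≡ sum< m (λ x → ∑[ j < n ] h j x)
∑-sum<-comm zero    m h = sym (sum<-zero m (λ _ _ → refl))
∑-sum<-comm (suc n) m h rewrite ∑-sum<-comm n m (λ j → h (suc j)) =
  sym (sum<-distrib-+ m (h zero) (λ x → ∑[ j < n ] h (suc j) x))

∑-δ : ∀ n (i : Fin n) → ∑[ j < n ] 𝟙 ⌊ i Fin.≟ j ⌋ ≡ 1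
∑-δ (suc n) zero    = cong suc (sum-replicate-zero n)
∑-δ (suc n) (suc i) = trans (sum-cong-≗ λ j → cong 𝟙 (suc≟suc i j)) (∑-δ n i)
  where
  suc≟suc : ∀ {n} (i j : Fin n) → ⌊ Fin.suc i Fin.≟ Fin.suc j ⌋ ≡ ⌊ i Fin.≟ j ⌋
  suc≟suc i j with i Fin.≟ j
  ... | yes refl = refl
  ... | no _     = refl

isJob-just : ∀ {n} (x : Maybe (Fin n)) j → isJob x j ≡ true → x ≡ just j
isJob-just (just i) j isJ with i Fin.≟ j
... | yes refl = refl

isJob-refl : ∀ {n} (j : Fin n) → isJob (just j) j ≡ true
isJob-refl j = ⌊⌋-true (j Fin.≟ j) refl

∑-isJob : ∀ {n} (x : Maybe (Fin n)) → ∑[ j < n ] 𝟙 (isJob x j) ≡ 𝟙 (is-just x)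
∑-isJob {n} nothing  = sum-replicate-zero n
∑-isJob {n} (just i) = ∑-δ n i

-- FeasibleSchedule I S is Placed I S × Exclusive I S × Complete I S. Processors are numbered
-- 1, …, m; the lemmas below write them as suc a with a < m I.
Placed : (I : Instance) → Schedule I → Set
Placed I S = ∀ k t j → S k t ≡ just j → (1 ≤ k) × (k ≤ m I) × (t ≤ d I) × (rel I j ≤ t) × (t ≤ dl I j)

Exclusive : (I : Instance) → Schedule I → Set
Exclusive I S = ∀ k k' t j → S k t ≡ just j → S k' t ≡ just j → k ≡ k'

Complete : (I : Instance) → Schedule I → Set
Complete I S = ∀ j → count (slots (d I)) (runs I S j) ≡ p I j

module _ (I : Instance) where

  count≡sum< : ∀ (P : ℕ → Bool) → count (slots (d I)) P ≡ sum< (suc (d I)) (λ t → 𝟙 (P t))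
  count≡sum< P = sum-map-upTo (suc (d I)) (λ t → 𝟙 (P t))

  volQ≡sum< : ∀ S Q → volQ I S Q ≡ sum< (suc (d I)) (λ t → if Q t then vol I S t else 0)
  volQ≡sum< S Q = sum-map-upTo (suc (d I)) _

  fv≡∑ : ∀ Q → fv I Q ≡ ∑[ j < n I ] (p I j ∸ sum< (suc (d I)) (λ t → 𝟙 (inE I j t ∧ not (Q t))))
  fv≡∑ Q = trans (sum-map-allFin (n I) _) (sum-cong-≗ λ j → cong (p I j ∸_) (count≡sum< _))

  vol≡sum< : ∀ S t → vol I S t ≡ sum< (m I) (λ a → 𝟙 (is-just (S (suc a) t)))
  vol≡sum< S t = trans (cong sum (sym (map-∘ (upTo (m I))))) (sum-map-upTo (m I) _)

  runs≡any< : ∀ S j t → runs I S j t ≡ any< (m I) (λ a → isJob (S (suc a) t) j)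
  runs≡any< S j t = trans (cong or (sym (map-∘ (upTo (m I))))) (any-upTo (m I) _)

  vol≤m : ∀ S t → vol I S t ≤ m I
  vol≤m S t = subst (_≤ m I) (sym (vol≡sum< S t)) (sum<-𝟙≤ (m I) _)

  free-processor : ∀ S t → vol I S t < m I → ∃[ a ] a < m I × S (suc a) t ≡ nothing
  free-processor S t vol<m with sum<-𝟙<⇒false (m I) _ (subst (_< m I) (vol≡sum< S t) vol<m)
  ... | a , a<m , free = a , a<m , is-just-false free
    where
    is-just-false : ∀ {A : Set} {x : Maybe A} → is-just x ≡ false → x ≡ nothing
    is-just-false {x = nothing} _ = refl

  runs-intro : ∀ S j t a → a < m I → S (suc a) t ≡ just j → runs I S j t ≡ true
  runs-intro S j t a a<m Sat = trans (runs≡any< S j t)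
    (any<-intro (m I) _ a a<m (trans (cong (λ x → isJob x j) Sat) (isJob-refl j)))

  runs-witness : ∀ S j t → runs I S j t ≡ true → ∃[ a ] a < m I × S (suc a) t ≡ just j
  runs-witness S j t r with any<-witness (m I) _ (trans (sym (runs≡any< S j t)) r)
  ... | a , a<m , isJ = a , a<m , isJob-just _ j isJ

  placed⇒inE : ∀ {S} → Placed I S → ∀ k t j → S k t ≡ just j → inE I j t ≡ true
  placed⇒inE placed k t j Skt with placed k t j Skt
  ... | _ , _ , t≤d , r≤t , t≤dl
    rewrite ⌊⌋-true (rel I j ≤? t) r≤t | ⌊⌋-true (t ≤? dl I j) t≤dl | ⌊⌋-true (t ≤? d I) t≤d = refl

  runs⇒inE : ∀ {S} → Placed I S → ∀ j t → runs I S j t ≡ true → inE I j t ≡ true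
  runs⇒inE {S} placed j t r = let a , _ , Sat = runs-witness S j t r in placed⇒inE placed (suc a) t j Sat

  inE⇒bounds : ∀ {j t} → inE I j t ≡ true → (t ≤ d I) × (rel I j ≤ t) × (t ≤ dl I j)
  inE⇒bounds {j} {t} e with rel I j ≤? t | t ≤? dl I j | t ≤? d I | e
  ... | yes r≤t | yes t≤dl | yes t≤d | _ = t≤d , r≤t , t≤dl

  placed⇒runs : ∀ {S} → Placed I S → ∀ {k t j} → S k t ≡ just j → runs I S j t ≡ true
  placed⇒runs {S} placed {k} {t} {j} Skt with placed k t j Skt
  ... | s≤s z≤n , k≤m , _ = runs-intro S j t (pred k) k≤m Skt

  vol≡∑runs : ∀ {S} → Exclusive I S → ∀ t → vol I S t ≡ ∑[ j < n I ] 𝟙 (runs I S j t)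
  vol≡∑runs {S} exclusive t = begin
    vol I S t                                                      ≡⟨ vol≡sum< S t ⟩
    sum< (m I) (λ a → 𝟙 (is-just (S (suc a) t)))                   ≡⟨ sum<-cong (m I) (λ a _ → ∑-isJob (S (suc a) t)) ⟨
    sum< (m I) (λ a → ∑[ j < n I ] 𝟙 (isJob (S (suc a) t) j))      ≡⟨ ∑-sum<-comm (n I) (m I) _ ⟨
    ∑[ j < n I ] sum< (m I) (λ a → 𝟙 (isJob (S (suc a) t) j))      ≡⟨ sum-cong-≗ (λ j → sum<-𝟙-unique (m I) _ (unique j)) ⟩
    ∑[ j < n I ] 𝟙 (any< (m I) (λ a → isJob (S (suc a) t) j))     ≡⟨ sum-cong-≗ (λ j → cong 𝟙 (runs≡any< S j t)) ⟨
    ∑[ j < n I ] 𝟙 (runs I S j t)                                  ∎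
    where
    open ≡-Reasoning
    unique : ∀ j a b → a < m I → b < m I → isJob (S (suc a) t) j ≡ true → isJob (S (suc b) t) j ≡ true → a ≡ b
    unique j a b _ _ isJa isJb = suc-injective (exclusive (suc a) (suc b) t j (isJob-just _ j isJa) (isJob-just _ j isJb))

-- Forced volume

NoEscape : (I : Instance) → Schedule I → (ℕ → Bool) → Set
NoEscape I S Q = ∀ j t t' → Q t ≡ true → runs I S j t ≡ true →
                 inE I j t' ≡ true → Q t' ≡ false → runs I S j t' ≡ true

module _ (I : Instance) (S : Schedule I) (Q : ℕ → Bool) where

  private
    D : ℕ
    D = suc (d I)

    inside outside free : Fin (n I) → ℕ
    inside  j = sum< D (λ t → 𝟙 (Q t ∧ runs I S j t))
    outside j = sum< D (λ t → 𝟙 (not (Q t) ∧ runs I S j t))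
    free    j = sum< D (λ t → 𝟙 (inE I j t ∧ not (Q t)))

    𝟙-split : ∀ q b → 𝟙 b ≡ 𝟙 (q ∧ b) + 𝟙 (not q ∧ b)
    𝟙-split true  b = sym (+-identityʳ (𝟙 b))
    𝟙-split false b = refl

    volume-split : Complete I S → ∀ j → p I j ≡ inside j + outside j
    volume-split complete j = begin
      p I j                                                          ≡⟨ complete j ⟨
      count (slots (d I)) (runs I S j)                               ≡⟨ count≡sum< I _ ⟩
      sum< D (λ t → 𝟙 (runs I S j t))                                ≡⟨ sum<-cong D (λ t _ → 𝟙-split (Q t) _) ⟩
      sum< D (λ t → 𝟙 (Q t ∧ runs I S j t) + 𝟙 (not (Q t) ∧ runs I S j t)) ≡⟨ sum<-distrib-+ D _ _ ⟩
      inside j + outside j                                           ∎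
      where open ≡-Reasoning

  -- A job running somewhere in Q fills its whole window outside Q; a job absent from Q has at
  -- least p_j free slots outside Q.
  forced-volume : FeasibleSchedule I S → NoEscape I S Q → ∀ j → p I j ∸ free j ≡ inside j
  forced-volume (placed , _ , complete) noEscape j with search< D (λ t → Q t ∧ runs I S j t)
  ... | inj₂ absent = trans (m≤n⇒m∸n≡0 p≤free) (sym inside≡0)
    where
    inside≡0 : inside j ≡ 0
    inside≡0 = sum<-zero D (λ t t<D → cong 𝟙 (absent t t<D))
    outside≤free : ∀ t → 𝟙 (not (Q t) ∧ runs I S j t) ≤ 𝟙 (inE I j t ∧ not (Q t))
    outside≤free t with Q t | runs I S j t in r
    ... | true  | _     = z≤n
    ... | false | false = z≤n
    ... | false | true  rewrite runs⇒inE I placed j t r = ≤-refl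
    p≤free : p I j ≤ free j
    p≤free = subst (_≤ free j) (sym (trans (volume-split complete j) (cong (_+ outside j) inside≡0)))
                   (sum<-mono-≤ D (λ t _ → outside≤free t))
  ... | inj₁ (t₀ , _ , Q∧runs) = begin
      p I j ∸ free j                ≡⟨ cong (_∸ free j) (volume-split complete j) ⟩
      inside j + outside j ∸ free j ≡⟨ cong (λ o → inside j + o ∸ free j) (sum<-cong D (λ t _ → fills t)) ⟩
      inside j + free j ∸ free j    ≡⟨ m+n∸n≡m (inside j) (free j) ⟩
      inside j                      ∎
    where
    open ≡-Reasoning
    Qt₀ : Q t₀ ≡ true
    Qt₀ = proj₁ (∧-true Q∧runs)
    runst₀ : runs I S j t₀ ≡ true
    runst₀ = proj₂ (∧-true Q∧runs)
    fills : ∀ t → 𝟙 (not (Q t) ∧ runs I S j t) ≡ 𝟙 (inE I j t ∧ not (Q t))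
    fills t with Q t in Qt
    ... | true rewrite ∧-zeroʳ (inE I j t) = refl
    ... | false with runs I S j t in r | inE I j t in e
    ...   | true  | true  = refl
    ...   | false | false = refl
    ...   | true  | false = contradiction (trans (sym (runs⇒inE I placed j t r)) e) λ ()
    ...   | false | true  = contradiction (trans (sym (noEscape j t₀ t Qt₀ runst₀ e Qt)) r) λ ()

  fv≡volQ : FeasibleSchedule I S → NoEscape I S Q → fv I Q ≡ volQ I S Q
  fv≡volQ F@(_ , exclusive , _) noEscape = begin
    fv I Q                                               ≡⟨ fv≡∑ I Q ⟩
    ∑[ j < n I ] (p I j ∸ free j)                        ≡⟨ sum-cong-≗ (forced-volume F noEscape) ⟩
    ∑[ j < n I ] inside j                                ≡⟨ ∑-sum<-comm (n I) D _ ⟩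
    sum< D (λ t → ∑[ j < n I ] 𝟙 (Q t ∧ runs I S j t))  ≡⟨ sum<-cong D (λ t _ → slot t) ⟩
    sum< D (λ t → if Q t then vol I S t else 0)          ≡⟨ volQ≡sum< I S Q ⟨
    volQ I S Q                                           ∎
    where
    open ≡-Reasoning
    slot : ∀ t → ∑[ j < n I ] 𝟙 (Q t ∧ runs I S j t) ≡ (if Q t then vol I S t else 0)
    slot t with Q t
    ... | true  = sym (vol≡∑runs I exclusive t)
    ... | false = sum-replicate-zero (n I)

δ : ℕ → ℕ → ℕ
δ u v = 𝟙 ⌊ u ≟ v ⌋

δ-refl : ∀ u → δ u u ≡ 1
δ-refl u = cong 𝟙 (⌊⌋-true (u ≟ u) refl)

δ-≢ : ∀ {u v} → u ≢ v → δ u v ≡ 0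
δ-≢ {u} {v} u≢v = cong 𝟙 (⌊⌋-false (u ≟ v) u≢v)

module _ (I : Instance) where

  -- Opaque, so that the arguments of setCell can be inferred from its applications.
  opaque
    setCell : Schedule I → ℕ → ℕ → Maybe (Fin (n I)) → Schedule I
    setCell S k u x k' u' = if ⌊ k' ≟ k ⌋ ∧ ⌊ u' ≟ u ⌋ then x else S k' u'

    setCell-cases : ∀ {S k u x} k' u' →
                    (k' ≡ k × u' ≡ u × setCell S k u x k' u' ≡ x) ⊎ setCell S k u x k' u' ≡ S k' u'
    setCell-cases {k = k} {u} k' u' with k' ≟ k | u' ≟ u
    ... | yes refl | yes refl = inj₁ (refl , refl , refl)
    ... | yes refl | no _     = inj₂ refl
    ... | no _     | _        = inj₂ refl

    setCell-here : ∀ {S k u x} → setCell S k u x k u ≡ x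
    setCell-here {k = k} {u} rewrite ⌊⌋-true (k ≟ k) refl | ⌊⌋-true (u ≟ u) refl = refl

  setCell-elsewhere : ∀ {S k u x k' u'} → ¬ (k' ≡ k × u' ≡ u) → setCell S k u x k' u' ≡ S k' u'
  setCell-elsewhere {k' = k'} {u'} other with setCell-cases k' u'
  ... | inj₁ (k'≡k , u'≡u , _) = contradiction (k'≡k , u'≡u) other
  ... | inj₂ unchanged          = unchanged

  setCell-otherSlot : ∀ {S k u x k' u'} → u' ≢ u → setCell S k u x k' u' ≡ S k' u'
  setCell-otherSlot u'≢u = setCell-elsewhere (u'≢u ∘ proj₂)

  module _ {S : Schedule I} {u : ℕ} {x : Maybe (Fin (n I))} where

    vol-setCell-here : ∀ {a} → a < m I → vol I (setCell S (suc a) u x) u + 𝟙 (is-just (S (suc a) u)) ≡ vol I S u + 𝟙 (is-just x)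
    vol-setCell-here {a} a<m = begin
      vol I S' u + 𝟙 (is-just (S (suc a) u))    ≡⟨ cong (_+ _) (vol≡sum< I S' u) ⟩
      sum< (m I) (cell S') + cell S a           ≡⟨ sum<-update (m I) (cell S') (cell S) a a<m unchanged ⟩
      sum< (m I) (cell S) + cell S' a           ≡⟨ cong₂ _+_ (sym (vol≡sum< I S u)) (cong (𝟙 ∘ is-just) setCell-here) ⟩
      vol I S u + 𝟙 (is-just x)                 ∎
      where
      open ≡-Reasoning
      S' : Schedule I
      S' = setCell S (suc a) u x
      cell : Schedule I → ℕ → ℕ
      cell T b = 𝟙 (is-just (T (suc b) u))
      unchanged : ∀ b → b < m I → b ≢ a → cell S' b ≡ cell S b
      unchanged b _ b≢a = cong (𝟙 ∘ is-just) (setCell-elsewhere (b≢a ∘ suc-injective ∘ proj₁))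

    vol-setCell-otherSlot : ∀ {k u'} → u' ≢ u → vol I (setCell S k u x) u' ≡ vol I S u'
    vol-setCell-otherSlot {k} {u'} u'≢u = begin
      vol I (setCell S k u x) u'                                ≡⟨ vol≡sum< I (setCell S k u x) u' ⟩
      sum< (m I) (λ b → 𝟙 (is-just (setCell S k u x (suc b) u'))) ≡⟨ sum<-cong (m I) (λ b _ → cong (𝟙 ∘ is-just) (setCell-otherSlot u'≢u)) ⟩
      sum< (m I) (λ b → 𝟙 (is-just (S (suc b) u')))                  ≡⟨ vol≡sum< I S u' ⟨
      vol I S u'                                                    ∎
      where open ≡-Reasoning

  runs-cellwise : ∀ S S' j t → (∀ k → isJob (S k t) j ≡ isJob (S' k t) j) → runs I S j t ≡ runs I S' j t
  runs-cellwise S S' j t same = cong or (map-cong same (procs (m I)))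

  runs-setCell-invisible : ∀ S k u x j → isJob x j ≡ isJob (S k u) j → ∀ t → runs I (setCell S k u x) j t ≡ runs I S j t
  runs-setCell-invisible S k u x j same t = runs-cellwise (setCell S k u x) S j t cellwise
    where
    cellwise : ∀ k' → isJob (setCell S k u x k' t) j ≡ isJob (S k' t) j
    cellwise k' with setCell-cases {S} {k} {u} {x} k' t
    ... | inj₁ (refl , refl , here) = trans (cong (λ y → isJob y j) here) same
    ... | inj₂ other                = cong (λ y → isJob y j) other

  runs-setCell-otherSlot : ∀ S k u x j {t} → t ≢ u → runs I (setCell S k u x) j t ≡ runs I S j t
  runs-setCell-otherSlot S k u x j {t} t≢u =
    runs-cellwise (setCell S k u x) S j t (λ k' → cong (λ y → isJob y j) (setCell-otherSlot t≢u))

  placed-remove : ∀ {S k u} → Placed I S → Placed I (setCell S k u nothing)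
  placed-remove {S} {k} {u} placed k' u' j' cell with setCell-cases {S} {k} {u} {nothing} k' u'
  ... | inj₁ (_ , _ , here) = contradiction (trans (sym here) cell) λ ()
  ... | inj₂ same           = placed k' u' j' (trans (sym same) cell)

  placed-insert : ∀ {S a u j} → Placed I S → a < m I → inE I j u ≡ true → Placed I (setCell S (suc a) u (just j))
  placed-insert {S} {a} {u} {j} placed a<m inE-u k' u' j' cell with setCell-cases {S} {suc a} {u} {just j} k' u'
  ... | inj₁ (refl , refl , here) with trans (sym here) cell
  ...   | refl = s≤s z≤n , a<m , inE⇒bounds I {j} inE-u
  placed-insert placed a<m inE-u k' u' j' cell | inj₂ same = placed k' u' j' (trans (sym same) cell)

  exclusive-remove : ∀ {S k u} → Exclusive I S → Exclusive I (setCell S k u nothing)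
  exclusive-remove {S} {k} {u} exclusive k₁ k₂ t j' cell₁ cell₂
    with setCell-cases {S} {k} {u} {nothing} k₁ t | setCell-cases {S} {k} {u} {nothing} k₂ t
  ... | inj₁ (_ , _ , here) | _                   = contradiction (trans (sym here) cell₁) λ ()
  ... | _                   | inj₁ (_ , _ , here) = contradiction (trans (sym here) cell₂) λ ()
  ... | inj₂ same₁          | inj₂ same₂          = exclusive k₁ k₂ t j' (trans (sym same₁) cell₁) (trans (sym same₂) cell₂)

  exclusive-insert : ∀ {S k u j} → Placed I S → Exclusive I S → runs I S j u ≡ false →
                     Exclusive I (setCell S k u (just j))
  exclusive-insert {S} {k} {u} {j} placed exclusive idle k₁ k₂ t j' cell₁ cell₂
    with setCell-cases {S} {k} {u} {just j} k₁ t | setCell-cases {S} {k} {u} {just j} k₂ t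
  ... | inj₁ (refl , _ , _)         | inj₁ (refl , _ , _)         = refl
  ... | inj₁ (_ , refl , here)      | inj₂ same
        with refl ← trans (sym here) cell₁ = contradiction idle (not-¬ (placed⇒runs I placed (trans (sym same) cell₂)))
  ... | inj₂ same                   | inj₁ (_ , refl , here)
        with refl ← trans (sym here) cell₂ = contradiction idle (not-¬ (placed⇒runs I placed (trans (sym same) cell₁)))
  ... | inj₂ same₁                  | inj₂ same₂ = exclusive k₁ k₂ t j' (trans (sym same₁) cell₁) (trans (sym same₂) cell₂)

  module _ {S : Schedule I} {a u : ℕ} (a<m : a < m I) where

    vol-setCell-remove : ∀ {j} → S (suc a) u ≡ just j → ∀ t → vol I (setCell S (suc a) u nothing) t + δ t u ≡ vol I S t
    vol-setCell-remove busy t with t ≟ u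
    ... | yes refl = begin
      vol I (setCell S (suc a) t nothing) t + 1                          ≡⟨ cong (λ y → vol I (setCell S (suc a) t nothing) t + 𝟙 (is-just y)) busy ⟨
      vol I (setCell S (suc a) t nothing) t + 𝟙 (is-just (S (suc a) t)) ≡⟨ vol-setCell-here a<m ⟩
      vol I S t + 0                                                      ≡⟨ +-identityʳ _ ⟩
      vol I S t                                                          ∎
      where open ≡-Reasoning
    ... | no t≢u = trans (+-identityʳ _) (vol-setCell-otherSlot t≢u)

    vol-setCell-insert : ∀ {j} → S (suc a) u ≡ nothing → ∀ t → vol I (setCell S (suc a) u (just j)) t ≡ vol I S t + δ t u
    vol-setCell-insert {j} idle t with t ≟ u
    ... | yes refl = begin
      vol I (setCell S (suc a) t (just j)) t                                ≡⟨ +-identityʳ _ ⟨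
      vol I (setCell S (suc a) t (just j)) t + 0                            ≡⟨ cong (λ y → vol I (setCell S (suc a) t (just j)) t + 𝟙 (is-just y)) idle ⟨
      vol I (setCell S (suc a) t (just j)) t + 𝟙 (is-just (S (suc a) t))    ≡⟨ vol-setCell-here a<m ⟩
      vol I S t + 1                                                         ∎
      where open ≡-Reasoning
    ... | no t≢u = trans (vol-setCell-otherSlot t≢u) (sym (+-identityʳ _))

-- S' is S with one unit of volume moved from slot `from` to slot `to`.
record VolumeShift (I : Instance) (S S' : Schedule I) (from to : ℕ) : Set where
  constructor volumeShift
  field shifted : ∀ u → vol I S' u + δ u from ≡ vol I S u + δ u to
open VolumeShift

volumeShift-refl : ∀ {I} (S : Schedule I) t → VolumeShift I S S t t
volumeShift-refl S t = volumeShift λ u → refl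

volumeShift-trans : ∀ {I S S' S'' r s t} → VolumeShift I S S' s t → VolumeShift I S' S'' r s → VolumeShift I S S'' r t
volumeShift-trans shift shift' = volumeShift λ u → trans (shifted shift' u) (shifted shift u)

module _ {I : Instance} {S S' : Schedule I} {a b : ℕ} (shift : VolumeShift I S S' a b) where

  volumeShift-source : a ≢ b → suc (vol I S' a) ≡ vol I S a
  volumeShift-source a≢b = begin
    suc (vol I S' a)      ≡⟨ +-comm 1 _ ⟩
    vol I S' a + 1        ≡⟨ cong (vol I S' a +_) (δ-refl a) ⟨
    vol I S' a + δ a a    ≡⟨ shifted shift a ⟩
    vol I S a + δ a b     ≡⟨ cong (vol I S a +_) (δ-≢ a≢b) ⟩
    vol I S a + 0         ≡⟨ +-identityʳ _ ⟩
    vol I S a             ∎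
    where open ≡-Reasoning

  volumeShift-target : a ≢ b → vol I S' b ≡ suc (vol I S b)
  volumeShift-target a≢b = begin
    vol I S' b            ≡⟨ +-identityʳ _ ⟨
    vol I S' b + 0        ≡⟨ cong (vol I S' b +_) (δ-≢ (a≢b ∘ sym)) ⟨
    vol I S' b + δ b a    ≡⟨ shifted shift b ⟩
    vol I S b + δ b b     ≡⟨ cong (vol I S b +_) (δ-refl b) ⟩
    vol I S b + 1         ≡⟨ +-comm _ 1 ⟩
    suc (vol I S b)       ∎
    where open ≡-Reasoning

  volumeShift-other : ∀ {s} → s ≢ a → s ≢ b → vol I S' s ≡ vol I S s
  volumeShift-other {s} s≢a s≢b = begin
    vol I S' s            ≡⟨ +-identityʳ _ ⟨
    vol I S' s + 0        ≡⟨ cong (vol I S' s +_) (δ-≢ s≢a) ⟨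
    vol I S' s + δ s a    ≡⟨ shifted shift s ⟩
    vol I S s + δ s b     ≡⟨ cong (vol I S s +_) (δ-≢ s≢b) ⟩
    vol I S s + 0         ≡⟨ +-identityʳ _ ⟩
    vol I S s             ∎
    where open ≡-Reasoning

  respects-shift : a ≢ b → ∀ {mb mb' lb} → RespectsBounds I S mb lb → (∀ s → s ≢ a → mb s ≤ mb' s) →
                   lb a < vol I S a → vol I S a ≤ suc (mb' a) → vol I S b < mb' b → RespectsBounds I S' mb' lb
  respects-shift a≢b {mb} {mb'} {lb} respects widen lb<vol-a vol-a≤ vol-b< s s≤d = case s ≟ a of λ where
    (yes refl) → let drop = volumeShift-source a≢b in
                 ≤-pred (subst (lb s <_) (sym drop) lb<vol-a) , ≤-pred (subst (_≤ suc (mb' s)) (sym drop) vol-a≤)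
    (no s≢a) → case s ≟ b of λ where
      (yes refl) → let rise = volumeShift-target a≢b in
                   subst (lb s ≤_) (sym rise) (m≤n⇒m≤1+n (proj₁ (respects s s≤d))) , subst (_≤ mb' s) (sym rise) vol-b<
      (no s≢b)   → let same = volumeShift-other s≢a s≢b in
                   subst (lb s ≤_) (sym same) (proj₁ (respects s s≤d)) ,
                   subst (_≤ mb' s) (sym same) (≤-trans (proj₂ (respects s s≤d)) (widen s s≢a))

moveJob : (I : Instance) → Schedule I → (a₀ s₀ a s : ℕ) → Fin (n I) → Schedule I
moveJob I S a₀ s₀ a s j = setCell I (setCell I S (suc a₀) s₀ nothing) (suc a) s (just j)

module MoveJob {I : Instance} {S : Schedule I} (F : FeasibleSchedule I S) {j : Fin (n I)} {a₀ s₀ a s : ℕ}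
         (a₀<m : a₀ < m I) (j-at-s₀ : S (suc a₀) s₀ ≡ just j)
         (a<m : a < m I) (a-idle-at-s : S (suc a) s ≡ nothing)
         (j-not-at-s : runs I S j s ≡ false) (s-in-window : inE I j s ≡ true) (s₀≢s : s₀ ≢ s) where

  private
    placed : Placed I S
    placed = proj₁ F
    exclusive : Exclusive I S
    exclusive = proj₁ (proj₂ F)
    complete : Complete I S
    complete = proj₂ (proj₂ F)
    removed moved : Schedule I
    removed = setCell I S (suc a₀) s₀ nothing
    moved = moveJob I S a₀ s₀ a s j
    D : ℕ
    D = suc (d I)

    removed-idle-at-s : removed (suc a) s ≡ nothing
    removed-idle-at-s = trans (setCell-otherSlot I (s₀≢s ∘ sym)) a-idle-at-s

    removed-j-not-at-s₀ : runs I removed j s₀ ≡ false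
    removed-j-not-at-s₀ = ¬-not λ r → let b , _ , cell = runs-witness I removed j s₀ r in nowhere b cell
      where
      nowhere : ∀ b → removed (suc b) s₀ ≢ just j
      nowhere b cell with b ≟ a₀
      ... | yes refl = contradiction (trans (sym (setCell-here I)) cell) λ ()
      ... | no b≢a₀  = b≢a₀ (suc-injective (exclusive (suc b) (suc a₀) s₀ j
                              (trans (sym (setCell-elsewhere I (b≢a₀ ∘ suc-injective ∘ proj₁))) cell) j-at-s₀))

    moved-j-at-s : runs I moved j s ≡ true
    moved-j-at-s = runs-intro I moved j s a a<m (setCell-here I)

    removed-runs-j : ∀ t → t ≢ s₀ → runs I removed j t ≡ runs I S j t
    removed-runs-j t t≢s₀ = runs-setCell-otherSlot I S (suc a₀) s₀ nothing j t≢s₀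

    moved-runs-j : ∀ t → t ≢ s → runs I moved j t ≡ runs I removed j t
    moved-runs-j t t≢s = runs-setCell-otherSlot I removed (suc a) s (just j) j t≢s

    moved-runs-other : ∀ x → x ≢ j → ∀ t → runs I moved x t ≡ runs I S x t
    moved-runs-other x x≢j t =
      trans (runs-setCell-invisible I removed (suc a) s (just j) x (trans j-not-x (cong (λ y → isJob y x) (sym removed-idle-at-s))) t)
            (runs-setCell-invisible I S (suc a₀) s₀ nothing x (sym (trans (cong (λ y → isJob y x) j-at-s₀) j-not-x)) t)
      where
      j-not-x : isJob (just j) x ≡ false
      j-not-x = ⌊⌋-false (j Fin.≟ x) (x≢j ∘ sym)

    s≤d : s ≤ d I
    s≤d = proj₁ (inE⇒bounds I {j} s-in-window)

    s₀≤d : s₀ ≤ d I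
    s₀≤d = proj₁ (proj₂ (proj₂ (placed (suc a₀) s₀ j j-at-s₀)))

    processing : Schedule I → ℕ
    processing T = sum< D (λ t → 𝟙 (runs I T j t))

    moved-processing : processing moved ≡ processing S
    moved-processing = begin
      processing moved                                 ≡⟨ +-identityʳ _ ⟨
      processing moved + 0                             ≡⟨ cong (λ r → processing moved + 𝟙 r) removed-j-not-at-s ⟨
      processing moved + 𝟙 (runs I removed j s)        ≡⟨ sum<-update D _ _ s (s≤s s≤d) (λ t _ t≢s → cong 𝟙 (moved-runs-j t t≢s)) ⟩
      processing removed + 𝟙 (runs I moved j s)        ≡⟨ cong (λ r → processing removed + 𝟙 r) moved-j-at-s ⟩
      processing removed + 1                           ≡⟨ cong (λ r → processing removed + 𝟙 r) S-j-at-s₀ ⟨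
      processing removed + 𝟙 (runs I S j s₀)           ≡⟨ sum<-update D _ _ s₀ (s≤s s₀≤d) (λ t _ t≢s₀ → cong 𝟙 (removed-runs-j t t≢s₀)) ⟩
      processing S + 𝟙 (runs I removed j s₀)           ≡⟨ cong (λ r → processing S + 𝟙 r) removed-j-not-at-s₀ ⟩
      processing S + 0                                 ≡⟨ +-identityʳ _ ⟩
      processing S                                     ∎
      where
      open ≡-Reasoning
      removed-j-not-at-s : runs I removed j s ≡ false
      removed-j-not-at-s = trans (removed-runs-j s (s₀≢s ∘ sym)) j-not-at-s
      S-j-at-s₀ : runs I S j s₀ ≡ true
      S-j-at-s₀ = runs-intro I S j s₀ a₀ a₀<m j-at-s₀

    processing-preserved : ∀ x → sum< D (λ t → 𝟙 (runs I moved x t)) ≡ sum< D (λ t → 𝟙 (runs I S x t))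
    processing-preserved x with x Fin.≟ j
    ... | yes refl = moved-processing
    ... | no x≢j   = sum<-cong D (λ t _ → cong 𝟙 (moved-runs-other x x≢j t))

  moveJob-feasible : FeasibleSchedule I moved
  moveJob-feasible = placed' , exclusive' , complete'
    where
    placed' : Placed I moved
    placed' = placed-insert I (placed-remove I placed) a<m s-in-window
    exclusive' : Exclusive I moved
    exclusive' = exclusive-insert I (placed-remove I placed) (exclusive-remove I exclusive)
                   (trans (removed-runs-j s (s₀≢s ∘ sym)) j-not-at-s)
    complete' : Complete I moved
    complete' x = begin
      count (slots (d I)) (runs I moved x) ≡⟨ count≡sum< I _ ⟩
      sum< D (λ t → 𝟙 (runs I moved x t)) ≡⟨ processing-preserved x ⟩
      sum< D (λ t → 𝟙 (runs I S x t))     ≡⟨ count≡sum< I _ ⟨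
      count (slots (d I)) (runs I S x)    ≡⟨ complete x ⟩
      p I x                               ∎
      where open ≡-Reasoning

  moveJob-volume : VolumeShift I S moved s₀ s
  moveJob-volume = volumeShift λ t → begin
    vol I moved t + δ t s₀               ≡⟨ cong (_+ δ t s₀) (vol-setCell-insert I a<m removed-idle-at-s t) ⟩
    vol I removed t + δ t s + δ t s₀     ≡⟨ xy∙z≈xz∙y (vol I removed t) (δ t s) (δ t s₀) ⟩
    vol I removed t + δ t s₀ + δ t s     ≡⟨ cong (_+ δ t s) (vol-setCell-remove I a₀<m j-at-s₀ t) ⟩
    vol I S t + δ t s                    ∎
    where open ≡-Reasoning

  moveJob-elsewhere : ∀ k t → t ≢ s → t ≢ s₀ → moved k t ≡ S k t
  moveJob-elsewhere k t t≢s t≢s₀ = trans (setCell-otherSlot I t≢s) (setCell-otherSlot I t≢s₀)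

  moveJob-within-s₀ : ∀ k j' → moved k s₀ ≡ just j' → S k s₀ ≡ just j'
  moveJob-within-s₀ k j' cell with setCell-cases I {S} {suc a₀} {s₀} {nothing} k s₀
  ... | inj₁ (_ , _ , here) = contradiction (trans (sym here) (trans (sym (setCell-otherSlot I s₀≢s)) cell)) λ ()
  ... | inj₂ same           = trans (sym same) (trans (sym (setCell-otherSlot I s₀≢s)) cell)

  moveJob-vacates : moved (suc a₀) s₀ ≡ nothing
  moveJob-vacates = trans (setCell-otherSlot I s₀≢s) (setCell-here I)

-- Reachability in a graph on the slots below D

module Reachability (D : ℕ) (edge : ℕ → ℕ → Bool) (root : ℕ) (root<D : root < D)
                    (edge-target<D : ∀ s₀ s → edge s₀ s ≡ true → s < D) where

  reach : ℕ → ℕ → Bool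
  reach zero    s = ⌊ s ≟ root ⌋
  reach (suc i) s = reach i s ∨ any< D (λ s₀ → reach i s₀ ∧ edge s₀ s)

  reach-root : ∀ i → reach i root ≡ true
  reach-root zero    = ⌊⌋-true (root ≟ root) refl
  reach-root (suc i) rewrite reach-root i = refl

  reach-mono : ∀ i {s} → reach i s ≡ true → reach (suc i) s ≡ true
  reach-mono i r rewrite r = refl

  reach-bounded : ∀ i s → reach i s ≡ true → s < D
  reach-bounded zero    s r with s ≟ root | r
  ... | yes refl | _ = root<D
  reach-bounded (suc i) s r with ∨-true {reach i s} r
  ... | inj₁ r' = reach-bounded i s r'
  ... | inj₂ e  = let s₀ , _ , r∧e = any<-witness D _ e in edge-target<D s₀ s (proj₂ (∧-true r∧e))

  reach-step : ∀ i {s₀ s} → reach i s₀ ≡ true → edge s₀ s ≡ true → reach (suc i) s ≡ true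
  reach-step i {s₀} {s} r e = trans (cong (reach i s ∨_) (any<-intro D _ s₀ (reach-bounded i s₀ r) (cong₂ _∧_ r e))) (∨-zeroʳ _)

  reach-ind : (P : ℕ → ℕ → Set) → P zero root → (∀ {i s} → P i s → P (suc i) s) →
              (∀ {i s₀ s} → reach i s₀ ≡ true → reach i s ≡ false → edge s₀ s ≡ true → P i s₀ → P (suc i) s) →
              ∀ i s → reach i s ≡ true → P i s
  reach-ind P base mono extend zero    s r with s ≟ root | r
  ... | yes refl | _ = base
  reach-ind P base mono extend (suc i) s r with reach i s in rᵢ
  ... | true  = mono (reach-ind P base mono extend i s rᵢ)
  ... | false = let s₀ , _ , r∧e = any<-witness D _ r ; r₀ , e = ∧-true r∧e in
                extend r₀ rᵢ e (reach-ind P base mono extend i s₀ r₀)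

  Stable : ℕ → Set
  Stable i = ∀ s → reach (suc i) s ≡ true → reach i s ≡ true

  stable-suc : ∀ {i} → Stable i → Stable (suc i)
  stable-suc {i} stable s r with ∨-true {reach (suc i) s} r
  ... | inj₁ r' = r'
  ... | inj₂ e  = let s₀ , _ , r∧e = any<-witness D _ e ; r₀ , e₀ = ∧-true r∧e in
                  reach-step i (stable s₀ r₀) e₀

  stable? : ∀ i → Stable i ⊎ ∃[ a ] a < D × reach (suc i) a ≡ true × reach i a ≡ false
  stable? i with search< D (λ s → reach (suc i) s ∧ not (reach i s))
  ... | inj₁ (a , a<D , fresh) = let new , old = ∧-true fresh in inj₂ (a , a<D , new , not-injective old)
  ... | inj₂ none = inj₁ λ s r →
        not-injective (trans (sym (cong (_∧ not (reach i s)) r)) (none s (reach-bounded (suc i) s r)))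

  size : ℕ → ℕ
  size i = sum< D (λ s → 𝟙 (reach i s))

  size-grows : ∀ i a → a < D → reach (suc i) a ≡ true → reach i a ≡ false → size i < size (suc i)
  size-grows i a a<D new old = sum<-mono-< D (λ s _ → 𝟙-mono (reach-mono i)) a a<D strict
    where
    𝟙-mono : ∀ {b c} → (b ≡ true → c ≡ true) → 𝟙 b ≤ 𝟙 c
    𝟙-mono {false} _   = z≤n
    𝟙-mono {true}  b⇒c rewrite b⇒c refl = ≤-refl
    strict : 𝟙 (reach i a) < 𝟙 (reach (suc i) a)
    strict rewrite old | new = ≤-refl

  stable-or-large : ∀ i → Stable i ⊎ suc i ≤ size (suc i)
  stable-or-large zero with stable? zero
  ... | inj₁ stable                = inj₁ stable
  ... | inj₂ (a , a<D , new , old) = inj₂ (≤-trans (s≤s z≤n) (size-grows zero a a<D new old))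
  stable-or-large (suc i) with stable? (suc i) | stable-or-large i
  ... | inj₁ stable                | _            = inj₁ stable
  ... | inj₂ (a , _ , new , old)   | inj₁ stable  = contradiction old (not-¬ (stable-suc {i} stable a new))
  ... | inj₂ (a , a<D , new , old) | inj₂ large   = inj₂ (≤-trans (s≤s large) (size-grows (suc i) a a<D new old))

  -- Every unstable round adds a slot, and there are only D slots.
  stable-D : Stable D
  stable-D with stable-or-large D
  ... | inj₁ stable = stable
  ... | inj₂ large  = contradiction (≤-trans large (sum<-𝟙≤ D _)) 1+n≰n

  closure : ℕ → Bool
  closure = reach D

  closure-closed : ∀ {s₀ s} → closure s₀ ≡ true → edge s₀ s ≡ true → closure s ≡ true
  closure-closed {s = s} r e = stable-D s (reach-step D r e)

-- Augmenting paths

anyFin-intro : ∀ {n} (P : Fin n → Bool) j → P j ≡ true → any P (allFin n) ≡ true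
anyFin-intro P j Pj = Equivalence.to T-≡ (any⁺ P (lose (∈-allFin j) (Equivalence.from T-≡ Pj)))

anyFin-witness : ∀ {n} (P : Fin n → Bool) → any P (allFin n) ≡ true → ∃[ j ] P j ≡ true
anyFin-witness {n} P anyP = let j , Pj = satisfied (any⁻ P (allFin n) (Equivalence.from T-≡ anyP)) in
                            j , Equivalence.to T-≡ Pj

module AugmentingPath {I : Instance} {S : Schedule I} (F : FeasibleSchedule I S) (t₁ : ℕ) (t₁≤d : t₁ ≤ d I) where

  movable : ℕ → ℕ → Bool
  movable s₀ s = any (λ j → runs I S j s₀ ∧ (not (runs I S j s) ∧ inE I j s)) (allFin (n I))

  record MovableJob (s₀ s : ℕ) : Set where
    field
      job           : Fin (n I)
      runs-source   : runs I S job s₀ ≡ true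
      idle-target   : runs I S job s ≡ false
      window-target : inE I job s ≡ true

  movable-witness : ∀ {s₀ s} → movable s₀ s ≡ true → MovableJob s₀ s
  movable-witness e = let j , r₀∧¬r∧w = anyFin-witness _ e ; r₀ , ¬r∧w = ∧-true r₀∧¬r∧w ; ¬r , w = ∧-true ¬r∧w in
                      record { job = j ; runs-source = r₀ ; idle-target = not-injective ¬r ; window-target = w }

  movable-intro : ∀ {j s₀ s} → runs I S j s₀ ≡ true → runs I S j s ≡ false → inE I j s ≡ true → movable s₀ s ≡ true
  movable-intro {j} r₀ ¬r w = anyFin-intro _ j (cong₂ _∧_ r₀ (cong₂ _∧_ (cong not ¬r) w))

  movable-target≤d : ∀ s₀ s → movable s₀ s ≡ true → s < suc (d I)
  movable-target≤d s₀ s e = s≤s (proj₁ (inE⇒bounds I {MovableJob.job witness} (MovableJob.window-target witness)))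
    where
    witness : MovableJob s₀ s
    witness = movable-witness e

  open Reachability (suc (d I)) movable t₁ (s≤s t₁≤d) movable-target≤d public

  closure-bounded : ∀ u → closure u ≡ true → u ≤ d I
  closure-bounded u Qu = ≤-pred (reach-bounded (suc (d I)) u Qu)

  closure-noEscape : NoEscape I S closure
  closure-noEscape j t t' Qt rt wt' Qt' =
    ¬-not λ ¬rt' → not-¬ (closure-closed {t} {t'} Qt (movable-intro rt ¬rt' wt')) Qt'

  -- S after the moves of an augmenting path beyond s, whose next move enters s from R.
  record Candidate (R : ℕ → Bool) (s : ℕ) (Sc : Schedule I) : Set where
    field
      feasible : FeasibleSchedule I Sc
      agrees   : ∀ u → R u ≡ true → u ≢ s → ∀ k → Sc k u ≡ S k u
      within   : ∀ k j → Sc k s ≡ just j → S k s ≡ just j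
      idle     : ∃[ a ] a < m I × Sc (suc a) s ≡ nothing

  candidate-shrink : ∀ {R R' s Sc} → (∀ u → R u ≡ true → R' u ≡ true) → Candidate R' s Sc → Candidate R s Sc
  candidate-shrink R⊆R' c = record { Candidate c ; agrees = λ u r → Candidate.agrees c u (R⊆R' u r) }

  -- The job that makes s₀ → s an edge runs at s₀ in S, hence in Sc, and is moved to s.
  candidate-step : ∀ {R s₀ s Sc} → R s₀ ≡ true → R s ≡ false → movable s₀ s ≡ true → Candidate R s Sc →
                   ∃[ Sn ] Candidate R s₀ Sn × VolumeShift I Sc Sn s₀ s
  candidate-step {R} {s₀} {s} {Sc} r₀ ¬r e c = moved , candidate , moveJob-volume
    where
    open Candidate c
    open MovableJob (movable-witness e)
    a₀ : ℕ
    a₀ = proj₁ (runs-witness I S job s₀ runs-source)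
    a₀<m : a₀ < m I
    a₀<m = proj₁ (proj₂ (runs-witness I S job s₀ runs-source))
    a : ℕ
    a = proj₁ idle
    a<m : a < m I
    a<m = proj₁ (proj₂ idle)
    outside : ∀ {u} → R u ≡ true → u ≢ s
    outside r u≡s = not-¬ (trans (sym (cong R u≡s)) r) ¬r
    job-at-s₀ : Sc (suc a₀) s₀ ≡ just job
    job-at-s₀ = trans (agrees s₀ r₀ (outside r₀) (suc a₀)) (proj₂ (proj₂ (runs-witness I S job s₀ runs-source)))
    job-not-at-s : runs I Sc job s ≡ false
    job-not-at-s = ¬-not λ r → let b , b<m , cell = runs-witness I Sc job s r in
                   not-¬ (runs-intro I S job s b b<m (within (suc b) job cell)) idle-target
    open MoveJob feasible a₀<m job-at-s₀ a<m (proj₂ (proj₂ idle)) job-not-at-s window-target (outside r₀)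
    moved : Schedule I
    moved = moveJob I Sc a₀ s₀ a s job
    candidate : Candidate R s₀ moved
    candidate = record
      { feasible = moveJob-feasible
      ; agrees   = λ u r u≢s₀ k → trans (moveJob-elsewhere k u (outside r) u≢s₀) (agrees u r (outside r) k)
      ; within   = λ k j' cell → trans (sym (agrees s₀ r₀ (outside r₀) k)) (moveJob-within-s₀ k j' cell)
      ; idle     = a₀ , a₀<m , moveJob-vacates
      }

  Augmentable : ℕ → ℕ → Set
  Augmentable i s = ∀ Sc → Candidate (reach i) s Sc → ∃[ S' ] FeasibleSchedule I S' × VolumeShift I Sc S' t₁ s

  augmentable-root : Augmentable zero t₁
  augmentable-root Sc c = Sc , Candidate.feasible c , volumeShift-refl Sc t₁

  augmentable-mono : ∀ {i s} → Augmentable i s → Augmentable (suc i) s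
  augmentable-mono {i} aug Sc c = aug Sc (candidate-shrink {reach i} {reach (suc i)} (λ u → reach-mono i) c)

  augmentable-extend : ∀ {i s₀ s} → reach i s₀ ≡ true → reach i s ≡ false → movable s₀ s ≡ true →
                       Augmentable i s₀ → Augmentable (suc i) s
  augmentable-extend {i} r₀ ¬r e aug Sc c =
    let Sn , cₙ , shiftₙ = candidate-step r₀ ¬r e (candidate-shrink {reach i} {reach (suc i)} (λ u → reach-mono i) c)
        S' , F' , shift  = aug Sn cₙ
    in S' , F' , volumeShift-trans shiftₙ shift

  augment : ∀ u → closure u ≡ true → vol I S u < m I → ∃[ S' ] FeasibleSchedule I S' × VolumeShift I S S' t₁ u
  augment u Qu vol<m = reach-ind Augmentable augmentable-root (λ {i} → augmentable-mono {i}) (λ {i} → augmentable-extend {i})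
                                 (suc (d I)) u Qu S
    record { feasible = F ; agrees = λ _ _ _ _ → refl ; within = λ _ _ cell → cell ; idle = free-processor I S u vol<m }

  -- Otherwise augment would produce a schedule respecting (mb', lb).
  closure-saturated : ∀ {mb mb' lb} → RespectsBounds I S mb lb → ¬ FeasibleBounds I mb' lb →
    (∀ s → s ≢ t₁ → mb s ≤ mb' s) → lb t₁ < vol I S t₁ → vol I S t₁ ≤ suc (mb' t₁) →
    ∀ u → closure u ≡ true → u ≢ t₁ → ∀ c → c ≤ mb' u → c ≤ m I → c ≤ vol I S u
  closure-saturated {mb} {mb'} {lb} respects infeasible widen lb<vol vol≤mb'+1 u Qu u≢t₁ c c≤mb' c≤m = ≮⇒≥ λ vol<c →
    let S' , F' , shift = augment u Qu (<-≤-trans vol<c c≤m) in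
    infeasible (S' , F' , respects-shift shift (u≢t₁ ∘ sym) respects widen lb<vol vol≤mb'+1 (<-≤-trans vol<c c≤mb'))

-- Invariants of PLTR

inRange-inside : ∀ {a b s} → a ≤ s → s < b → inRange a b s ≡ true
inRange-inside {a} {b} {s} a≤s s<b = cong₂ _∧_ (⌊⌋-true (a ≤? s) a≤s) (⌊⌋-true (s <? b) s<b)

inRange-outside : ∀ {a b s} → s < a ⊎ b ≤ s → inRange a b s ≡ false
inRange-outside {a} {b} {s} (inj₁ s<a) = cong (_∧ ⌊ s <? b ⌋) (⌊⌋-false (a ≤? s) (<⇒≱ s<a))
inRange-outside {a} {b} {s} (inj₂ b≤s) = trans (cong (⌊ a ≤? s ⌋ ∧_) (⌊⌋-false (s <? b) (≤⇒≯ b≤s))) (∧-zeroʳ _)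

module _ (k a b : ℕ) where

  capM-inside : ∀ mb {s} → a ≤ s → s < b → capM k a b mb s ≡ k ∸ 1
  capM-inside mb a≤s s<b rewrite inRange-inside a≤s s<b = refl

  capM-outside : ∀ mb {s} → s < a ⊎ b ≤ s → capM k a b mb s ≡ mb s
  capM-outside mb out rewrite inRange-outside {a} {b} out = refl

  capM-≥ : ∀ mb {s c} → c ≤ k ∸ 1 → c ≤ mb s → c ≤ capM k a b mb s
  capM-≥ mb {s} c≤k-1 c≤mb with inRange a b s
  ... | true  = c≤k-1
  ... | false = c≤mb

  capM-≤ : ∀ mb {s} → k ∸ 1 ≤ mb s → capM k a b mb s ≤ mb s
  capM-≤ mb {s} k-1≤mb with inRange a b s
  ... | true  = k-1≤mb
  ... | false = ≤-refl

  raiseL-inside : ∀ lb {s} → a ≤ s → s < b → raiseL k a b lb s ≡ k ⊔ lb s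
  raiseL-inside lb a≤s s<b rewrite inRange-inside a≤s s<b = refl

  raiseL-outside : ∀ lb {s} → s < a ⊎ b ≤ s → raiseL k a b lb s ≡ lb s
  raiseL-outside lb out rewrite inRange-outside {a} {b} out = refl

  raiseL-free : ∀ lb {s c} → c < k → lb s ≡ 0 ⊎ c < lb s → raiseL k a b lb s ≡ 0 ⊎ c < raiseL k a b lb s
  raiseL-free lb {s} c<k free with inRange a b s
  ... | true  = inj₂ (<-≤-trans c<k (m≤m⊔n k (lb s)))
  ... | false = free

  raiseL-≥ : ∀ lb s → lb s ≤ raiseL k a b lb s
  raiseL-≥ lb s with inRange a b s
  ... | true  = m≤n⊔m k (lb s)
  ... | false = ≤-refl

capM-extend : ∀ k a b mb {s} → s ≢ b → capM k a b mb s ≡ capM k a (suc b) mb s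
capM-extend k a b mb {s} s≢b = case a ≤? s of λ where
  (no a≰s)  → trans (capM-outside k a b mb {s} (inj₁ (≰⇒> a≰s))) (sym (capM-outside k a (suc b) mb {s} (inj₁ (≰⇒> a≰s))))
  (yes a≤s) → case s <? b of λ where
    (yes s<b) → trans (capM-inside k a b mb {s} a≤s s<b) (sym (capM-inside k a (suc b) mb {s} a≤s (m<n⇒m<1+n s<b)))
    (no s≮b)  → trans (capM-outside k a b mb {s} (inj₂ (≮⇒≥ s≮b)))
                      (sym (capM-outside k a (suc b) mb {s} (inj₂ (≤∧≢⇒< (≮⇒≥ s≮b) (s≢b ∘ sym)))))

record Tighter (mb' lb' mb lb : ℕ → ℕ) : Set where
  field
    upper-≤ : ∀ s → mb' s ≤ mb s
    lower-≥ : ∀ s → lb s ≤ lb' s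
open Tighter

tighter-refl : ∀ {mb lb} → Tighter mb lb mb lb
tighter-refl = record { upper-≤ = λ _ → ≤-refl ; lower-≥ = λ _ → ≤-refl }

tighter-trans : ∀ {mb'' lb'' mb' lb' mb lb} → Tighter mb'' lb'' mb' lb' → Tighter mb' lb' mb lb → Tighter mb'' lb'' mb lb
tighter-trans t₂ t₁ = record { upper-≤ = λ s → ≤-trans (upper-≤ t₂ s) (upper-≤ t₁ s)
                             ; lower-≥ = λ s → ≤-trans (lower-≥ t₁ s) (lower-≥ t₂ s) }

respects-tighter : ∀ I S {mb' lb' mb lb} → Tighter mb' lb' mb lb → RespectsBounds I S mb' lb' → RespectsBounds I S mb lb
respects-tighter I S tighter respects t t≤d =
  ≤-trans (lower-≥ tighter t) (proj₁ (respects t t≤d)) , ≤-trans (proj₂ (respects t t≤d)) (upper-≤ tighter t)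

-- The bounds at slot s do not constrain processors 1, …, K.
record FreeUpTo (K : ℕ) (mb lb : ℕ → ℕ) (s : ℕ) : Set where
  field
    upper-free : K ≤ mb s
    lower-free : lb s ≡ 0 ⊎ K < lb s
open FreeUpTo

freeUpTo-pred : ∀ {K mb lb s} → FreeUpTo (suc K) mb lb s → FreeUpTo K mb lb s
freeUpTo-pred free = record { upper-free = <⇒≤ (upper-free free) ; lower-free = Data.Sum.map₂ <⇒≤ (lower-free free) }

-- In the round of processor suc K, the loop has so far only touched slots before t.
record RoundInvariant (K t : ℕ) (mb lb : ℕ → ℕ) : Set where
  field
    behind : ∀ s → FreeUpTo K mb lb s
    ahead  : ∀ s → t ≤ s → FreeUpTo (suc K) mb lb s
open RoundInvariant

roundInvariant-start : ∀ {K mb lb} → (∀ s → FreeUpTo (suc K) mb lb s) → RoundInvariant K 0 mb lb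
roundInvariant-start free = record { behind = freeUpTo-pred ∘ free ; ahead = λ s _ → free s }

module _ {K t t₁ t₂ : ℕ} {mb lb : ℕ → ℕ} where

  roundStep-tighter : (∀ s → FreeUpTo K mb lb s) → Tighter (capM (suc K) t t₁ mb) (raiseL (suc K) t₁ t₂ lb) mb lb
  roundStep-tighter free = record { upper-≤ = λ s → capM-≤ (suc K) t t₁ mb (upper-free (free s))
                                  ; lower-≥ = raiseL-≥ (suc K) t₁ t₂ lb }

  roundStep-invariant : t ≤ t₁ → t₁ ≤ t₂ → RoundInvariant K t mb lb →
                        RoundInvariant K t₂ (capM (suc K) t t₁ mb) (raiseL (suc K) t₁ t₂ lb)
  roundStep-invariant t≤t₁ t₁≤t₂ inv = record { behind = λ s → record { upper-free = capped s ; lower-free = raised s }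
                                              ; ahead = ahead′ }
    where
    capped : ∀ s → K ≤ capM (suc K) t t₁ mb s
    capped s = capM-≥ (suc K) t t₁ mb ≤-refl (upper-free (behind inv s))
    raised : ∀ s → raiseL (suc K) t₁ t₂ lb s ≡ 0 ⊎ K < raiseL (suc K) t₁ t₂ lb s
    raised s = raiseL-free (suc K) t₁ t₂ lb ≤-refl (lower-free (behind inv s))
    ahead′ : ∀ s → t₂ ≤ s → FreeUpTo (suc K) (capM (suc K) t t₁ mb) (raiseL (suc K) t₁ t₂ lb) s
    ahead′ s t₂≤s = record
      { upper-free = subst (suc K ≤_) (sym (capM-outside (suc K) t t₁ mb {s} (inj₂ (≤-trans t₁≤t₂ t₂≤s)))) (upper-free old)
      ; lower-free = subst (λ l → l ≡ 0 ⊎ suc K < l) (sym (raiseL-outside (suc K) t₁ t₂ lb {s} (inj₂ t₂≤s))) (lower-free old) }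
      where
      old : FreeUpTo (suc K) mb lb s
      old = ahead inv s (≤-trans t≤t₁ (≤-trans t₁≤t₂ t₂≤s))

loop-result : ∀ {I K t mb lb mb' lb'} → Loop I (suc K) t mb lb mb' lb' → RoundInvariant K t mb lb →
              Tighter mb' lb' mb lb × (∀ s → FreeUpTo K mb' lb' s)
loop-result (stop _) inv = tighter-refl , behind inv
loop-result {K = K} {t} (step {t₁ = t₁} {t₂} _ idle busy rest) inv
  with loop-result rest (roundStep-invariant (proj₁ idle) (proj₁ busy) inv)
... | tighter , free = tighter-trans tighter (roundStep-tighter {K} {t} {t₁} {t₂} (behind inv)) , free

outer-tighter : ∀ {I K mb lb mb' lb'} → Outer I K mb lb mb' lb' → (∀ s → FreeUpTo K mb lb s) → Tighter mb' lb' mb lb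
outer-tighter done _ = tighter-refl
outer-tighter (next loop rest) free with loop-result loop (roundInvariant-start free)
... | tighter , free' = tighter-trans (outer-tighter rest free') tighter

record Round (I : Instance) (mbF lbF : ℕ → ℕ) (K : ℕ) : Set where
  field
    mb lb mb' lb' : ℕ → ℕ
    loop : Loop I (suc K) 0 mb lb mb' lb'
    invariant : RoundInvariant K 0 mb lb
    final-tighter : Tighter mbF lbF mb' lb'

findRound : ∀ {I K' mb lb mbF lbF} → Outer I K' mb lb mbF lbF → (∀ s → FreeUpTo K' mb lb s) →
            ∀ K → K < K' → Round I mbF lbF K
findRound {K' = suc K'} (next loop rest) free K K<K' with K ≟ K'
... | yes refl = record { loop = loop ; invariant = roundInvariant-start free
                        ; final-tighter = outer-tighter rest (proj₂ (loop-result loop (roundInvariant-start free))) }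
... | no K≢K'  = findRound rest (proj₂ (loop-result loop (roundInvariant-start free))) K (≤∧≢⇒< (≤-pred K<K') K≢K')

-- Tight sets at engagements

TightSet : (I : Instance) → Schedule I → ℕ → ℕ → Set
TightSet I S k t = Σ (ℕ → Bool) λ Q →
  (∀ u → Q u ≡ true → u ≤ d I)
  × (Q t ≡ true)
  × (fv I Q ≡ volQ I S Q)
  × (∀ u → Q u ≡ true → k ∸ 1 ≤ vol I S u)
  × (∀ u → Q u ≡ true → t ≤ u → k ≤ vol I S u)

tightSet-weaken : ∀ {I S k k' t} → k' ≤ k → TightSet I S k t → TightSet I S k' t
tightSet-weaken {k = k} {k'} k'≤k (Q , bounded , Qt , fv≡vol , level , level-ahead) =
  Q , bounded , Qt , fv≡vol , (λ u Qu → ≤-trans (∸-monoˡ-≤ 1 k'≤k) (level u Qu)) ,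
  (λ u Qu t≤u → ≤-trans k'≤k (level-ahead u Qu t≤u))

-- t₁ ends an idle phase of processor suc K: the upper bound K could not be extended to t₁.
idleEnd-tight : ∀ {I S K t t₁ mb lb} → FeasibleSchedule I S → RoundInvariant K t mb lb → t ≤ t₁ → t₁ ≤ d I →
  vol I S t₁ ≡ suc K → lb t₁ ≡ 0 → RespectsBounds I S (capM (suc K) t t₁ mb) lb →
  ¬ FeasibleBounds I (capM (suc K) t (suc t₁) mb) lb → TightSet I S (suc K) t₁
idleEnd-tight {I} {S} {K} {t} {t₁} {mb} {lb} F inv t≤t₁ t₁≤d vol-t₁ lb-t₁ respects maximal =
  closure , closure-bounded , reach-root (suc (d I)) , fv≡volQ I S closure F closure-noEscape , level , level-ahead
  where
  open AugmentingPath {I} {S} F t₁ t₁≤d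
  k≤m : suc K ≤ m I
  k≤m = subst (_≤ m I) vol-t₁ (vol≤m I S t₁)
  saturated : ∀ u → closure u ≡ true → u ≢ t₁ → ∀ c → c ≤ capM (suc K) t (suc t₁) mb u → c ≤ m I → c ≤ vol I S u
  saturated = closure-saturated {capM (suc K) t t₁ mb} {capM (suc K) t (suc t₁) mb} {lb} respects maximal
    (λ s s≢t₁ → ≤-reflexive (capM-extend (suc K) t t₁ mb s≢t₁))
    (subst₂ _<_ (sym lb-t₁) (sym vol-t₁) z<s)
    (subst₂ _≤_ (sym vol-t₁) (cong suc (sym (capM-inside (suc K) t (suc t₁) mb {t₁} t≤t₁ ≤-refl))) ≤-refl)
  level : ∀ u → closure u ≡ true → K ≤ vol I S u
  level u Qu = case u ≟ t₁ of λ where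
    (yes u≡t₁) → subst (K ≤_) (sym (trans (cong (vol I S) u≡t₁) vol-t₁)) (n≤1+n K)
    (no u≢t₁)  → saturated u Qu u≢t₁ K (capM-≥ (suc K) t (suc t₁) mb ≤-refl (upper-free (behind inv u))) (≤-trans (n≤1+n K) k≤m)
  level-ahead : ∀ u → closure u ≡ true → t₁ ≤ u → suc K ≤ vol I S u
  level-ahead u Qu t₁≤u = case u ≟ t₁ of λ where
    (yes u≡t₁) → ≤-reflexive (sym (trans (cong (vol I S) u≡t₁) vol-t₁))
    (no u≢t₁)  → saturated u Qu u≢t₁ (suc K)
                   (subst (suc K ≤_) (sym (capM-outside (suc K) t (suc t₁) mb {u} (inj₂ (≤∧≢⇒< t₁≤u (u≢t₁ ∘ sym)))))
                          (upper-free (ahead inv u (≤-trans t≤t₁ t₁≤u))))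
                   k≤m

IdleBefore : (I : Instance) → Schedule I → ℕ → ℕ → Set
IdleBefore I S k zero    = ⊤
IdleBefore I S k (suc t) = vol I S t < k

-- t* cannot lie in an idle phase [t, t₁) (capacity K there) nor strictly inside a busy phase
-- (t₁, t₂) (the slot before it is then forced busy), so it is the end t₁ of an idle phase.
loop-engagement : ∀ {I S K t mb lb mb' lb'} → FeasibleSchedule I S → Loop I (suc K) t mb lb mb' lb' →
  RoundInvariant K t mb lb → RespectsBounds I S mb' lb' →
  ∀ t* → t ≤ t* → t* ≤ d I → vol I S t* ≡ suc K → IdleBefore I S (suc K) t* → TightSet I S (suc K) t*
loop-engagement F (stop d<t) inv respects t* t≤t* t*≤d = contradiction (≤-trans t≤t* t*≤d) (<⇒≱ d<t)
loop-engagement {I} {S} {K} {t} {mb} {lb} {mb'} {lb'} F (step {t₁ = t₁} {t₂} _ idle busy rest) inv respects t* t≤t* t*≤d vol-t* idleBefore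
  with loop-result rest (roundStep-invariant (proj₁ idle) (proj₁ busy) inv) | <-cmp t* t₁
... | tighter , _ | tri< t*<t₁ _ _ = contradiction vol≤K (1+n≰n ∘ subst (_≤ K) vol-t*)
  where
  vol≤K : vol I S t* ≤ K
  vol≤K = ≤-trans (proj₂ (respects t* t*≤d))
            (≤-trans (upper-≤ tighter t*) (≤-reflexive (capM-inside (suc K) t t₁ mb t≤t* t*<t₁)))
... | tighter , _ | tri≈ _ refl _ = idleEnd-tight F inv t≤t* t*≤d vol-t* lb-t* respects' maximal
  where
  after-idle : Tighter mb' lb' (capM (suc K) t t* mb) lb
  after-idle = tighter-trans tighter record { upper-≤ = λ _ → ≤-refl ; lower-≥ = lower-≥ (roundStep-tighter {K} {t} {t*} {t₂} (behind inv)) }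
  respects' : RespectsBounds I S (capM (suc K) t t* mb) lb
  respects' = respects-tighter I S after-idle respects
  lb-t* : lb t* ≡ 0
  lb-t* with lower-free (ahead inv t* t≤t*)
  ... | inj₁ lb≡0 = lb≡0
  ... | inj₂ K<lb = contradiction (≤-trans K<lb (subst (lb t* ≤_) vol-t* (proj₁ (respects' t* t*≤d)))) 1+n≰n
  maximal : ¬ FeasibleBounds I (capM (suc K) t (suc t*) mb) lb
  maximal = proj₂ (proj₂ (proj₂ idle)) (suc t*) ≤-refl (s≤s t*≤d)
... | tighter , _ | tri> _ _ t₁<t* with t₂ ≤? t*
...   | yes t₂≤t* = loop-engagement F rest (roundStep-invariant (proj₁ idle) (proj₁ busy) inv) respects t* t₂≤t* t*≤d vol-t* idleBefore
...   | no t₂≰t* = contradiction idleBefore (busyBefore t* t₁<t* (≰⇒> t₂≰t*) t*≤d)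
  where
  busyBefore : ∀ u → t₁ < u → u < t₂ → u ≤ d I → ¬ IdleBefore I S (suc K) u
  busyBefore (suc u) (s≤s t₁≤u) u<t₂ u<d vol<k = contradiction (≤-trans raised (proj₁ (respects u (<⇒≤ u<d)))) (<⇒≱ vol<k)
    where
    raised : suc K ≤ _
    raised = ≤-trans (≤-trans (m≤m⊔n (suc K) (lb u)) (≤-reflexive (sym (raiseL-inside (suc K) t₁ t₂ lb t₁≤u (<⇒≤ u<t₂)))))
                     (lower-≥ tighter u)

idleBefore-mono : ∀ {I S k k'} t → k ≤ k' → IdleBefore I S k t → IdleBefore I S k' t
idleBefore-mono zero    _    _   = _
idleBefore-mono (suc t) k≤k' v<k = <-≤-trans v<k k≤k'

engagement-idleBefore : ∀ {I S k t} → LowestProcessors I S → 1 ≤ k → k ≤ m I → Engagement I S k t → IdleBefore I S k t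
engagement-idleBefore {t = zero} _ _ _ _ = _
engagement-idleBefore {I} {S} {k} {suc t'} lowest 1≤k k≤m (b , t≤b , b≤d , busyOn , maximal) =
  ≰⇒> λ k≤vol → 1+n≰n (≤-reflexive (sym (proj₁ (maximal t' b (n≤1+n t') ≤-refl b≤d (busyFrom-t' k≤vol)))))
  where
  busyFrom-t' : k ≤ vol I S t' → BusyOn I S k t' b
  busyFrom-t' k≤vol s t'≤s s≤b with s ≟ t'
  ... | yes refl = proj₂ (lowest k t' 1≤k k≤m (≤-trans (n≤1+n t') (≤-trans t≤b b≤d))) k≤vol
  ... | no s≢t'  = busyOn s (≤∧≢⇒< t'≤s (s≢t' ∘ sym)) s≤b

pltrOutput-tight : ∀ {I S} → PLTROutput I S → ∀ K t → t ≤ d I → vol I S t ≡ suc K →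
                   IdleBefore I S (suc K) t → TightSet I S (suc K) t
pltrOutput-tight {I} {S} (_ , _ , outer , F , respects , _) K t t≤d vol-t idle =
  loop-engagement F loop invariant (respects-tighter I S final-tighter respects) t z≤n t≤d vol-t idle
  where
  initially-free : ∀ s → FreeUpTo (m I) (λ _ → m I) (λ _ → 0) s
  initially-free s = record { upper-free = ≤-refl ; lower-free = inj₁ refl }
  open Round (findRound outer initially-free K (subst (_≤ m I) vol-t (vol≤m I S t)))

lemma5 : (I : Instance) → FeasibleInstance I →
         (S : Schedule I) → PLTROutput I S →
         (k t : ℕ) → 1 ≤ k → k ≤ m I → Engagement I S k t →
         Σ (ℕ → Bool) λ Q →
           (∀ u → Q u ≡ true → u ≤ d I)
           × (Q t ≡ true)
           × (fv I Q ≡ volQ I S Q)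
           × (∀ u → Q u ≡ true → k ∸ 1 ≤ vol I S u)
           × (∀ u → Q u ≡ true → t ≤ u → k ≤ vol I S u)
lemma5 I _ S output@(_ , _ , _ , _ , _ , lowest) k t 1≤k k≤m engagement@(b , t≤b , b≤d , busyOn , _) =
  tightSet-weaken {I} {S} {t = t} k≤vol (tightAtVolume (vol I S t) refl k≤vol)
  where
  t≤d : t ≤ d I
  t≤d = ≤-trans t≤b b≤d
  k≤vol : k ≤ vol I S t
  k≤vol = proj₁ (lowest k t 1≤k k≤m t≤d) (busyOn t ≤-refl t≤b)
  tightAtVolume : ∀ v → vol I S t ≡ v → k ≤ v → TightSet I S v t
  tightAtVolume zero    _     k≤0 = contradiction (≤-trans 1≤k k≤0) λ ()
  tightAtVolume (suc K) vol-t k≤v =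
    pltrOutput-tight output K t t≤d vol-t (idleBefore-mono t k≤v (engagement-idleBefore lowest 1≤k k≤m engagement))
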